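{- Let $m\ge1$, let $k_1,\ldots,k_m\ge 2$ be integers with $k_1+\cdots+k_m=n$, and let $G=D_n(k_1,\ldots,k_m)$. Then $G$ is well-covered.
   Context: $D_n(k_1,\ldots,k_m)$ is the graph on the $5n$ vertices $X\cup Y\cup Z$ with $X=\{x_1,\ldots,x_{2n}\}$, $Y=\{y_1,\ldots,y_{2n}\}$, $Z=\{z_1,\ldots,z_n\}$, whose edges are exactly: (i) all pairs in $Z$ (so $Z$ induces $K_n$); (ii) no edges within $Y$; (iii) the induced graph on $X$ is a disjoint union $K_{k_1,k_1}\sqcup\cdots\sqcup K_{k_m,k_m}$ where, with $w=\sum_{\ell=1}^{i-1}k_\ell$ ($w=0$ for $i=1$), the $i$-th complete bipartite graph has bipartition $\{x_{2w+1},x_{2w+3},\ldots,x_{2(w+k_i)-1}\}\cup\{x_{2w+2},x_{2w+4},\ldots,x_{2(w+k_i)}\}$; (iv) $\{x_j,y_j\}$ for $1\le j\le 2n$; (v) $\{z_j,y_{2j}\}$ and $\{z_j,y_{2j-1}\}$ for $1\le j\le n$. A graph is well-covered if all its maximal independent sets have the same cardinality. -}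

module Defs where

open import Data.Nat using (ℕ; _+_; _*_; _∸_; _<_; _≤_; _%_)
open import Data.Fin using (Fin; toℕ)
open import Data.List using (List; []; _∷_; length)
open import Data.List.Membership.Propositional using (_∈_; _∉_)
open import Data.List.Relation.Unary.Unique.Propositional using (Unique)
open import Data.Product using (_×_; ∃; _,_)
open import Data.Sum using (_⊎_)
open import Data.Empty using (⊥)
open import Relation.Nullary using (¬_)
open import Relation.Binary.PropositionalEquality using (_≡_; _≢_)

-- Generic graph notions.  A graph is a vertex type with an adjacency
-- relation.  A finite vertex set is represented by a duplicate-free list.

record Graph : Set₁ where
  field
    V   : Set
    Adj : V → V → Set
open Graph public

Independent : (G : Graph) → List (V G) → Set
Independent G S = ∀ {u v} → u ∈ S → v ∈ S → ¬ Adj G u v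

MaximalIndependent : (G : Graph) → List (V G) → Set
MaximalIndependent G S =
  Unique S × Independent G S ×
  (∀ v → v ∉ S → ∃ λ u → u ∈ S × Adj G u v)

WellCovered : Graph → Set
WellCovered G = ∀ S T → MaximalIndependent G S → MaximalIndependent G T →
                length S ≡ length T

-- The graph D_n(k_1,...,k_m).  Indices are 0-based:
-- x j  (j : Fin (2n)) is x_{j+1},  y j is y_{j+1},  z j (j : Fin n) is z_{j+1}.

data DV (n : ℕ) : Set where
  x : Fin (2 * n) → DV n
  y : Fin (2 * n) → DV n
  z : Fin n → DV n

-- SameBlock ks a b : the 0-based X-indices a and b lie in the same block
-- {2w, ..., 2(w+k_i)-1} (0-based) of the decomposition given by ks.
SameBlock : List ℕ → ℕ → ℕ → Set
SameBlock []       a b = ⊥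
SameBlock (k ∷ ks) a b =
  (a < 2 * k × b < 2 * k) ⊎
  (2 * k ≤ a × 2 * k ≤ b × SameBlock ks (a ∸ 2 * k) (b ∸ 2 * k))

-- one orientation of each edge
data DEdge (n : ℕ) (ks : List ℕ) : DV n → DV n → Set where
  zz : ∀ {i j} → i ≢ j → DEdge n ks (z i) (z j)
  -- (iii) X induces the disjoint union of K_{k_i,k_i}: same block, opposite parity
  xx : ∀ {a b} → SameBlock ks (toℕ a) (toℕ b) → toℕ a % 2 ≢ toℕ b % 2 →
       DEdge n ks (x a) (x b)
  xy : ∀ j → DEdge n ks (x j) (y j)
  -- (v) z_j y_{2j-1}, z_j y_{2j}  (1-based), i.e. z j ~ y (2j), y (2j+1) 0-based
  zy : ∀ (j : Fin n) (t : Fin (2 * n)) →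
       (toℕ t ≡ 2 * toℕ j ⊎ toℕ t ≡ 2 * toℕ j + 1) → DEdge n ks (z j) (y t)

D : (n : ℕ) → List ℕ → Graph
D n ks = record { V = DV n ; Adj = λ u v → DEdge n ks u v ⊎ DEdge n ks v u }

-- Split the 5n vertices into the n five-element sets
-- {x_{2j-1}, x_{2j}, y_{2j}, z_j, y_{2j-1}}, each of which induces a 5-cycle.
-- A maximal independent set S meets each of them in exactly two vertices:
-- at most two by independence on the cycle, and at least two because S
-- dominates the y's (whose only neighbours lie on the cycle) and because
-- z_j ∈ S while x_{2j-1}, x_{2j} ∉ S is impossible: both x's would then be
-- dominated by x's of S of opposite parities in the block of K_{k_i,k_i}
-- containing x_{2j-1} x_{2j}, and those two would be adjacent.  Hence
-- |S| = 2n.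
module Submission where

open import Defs
open import Data.Nat using (ℕ; _≤_)
open import Data.List using (List; length)
open import Data.Nat.ListAction using (sum)
open import Data.List.Relation.Unary.All using (All)
open import Relation.Binary.PropositionalEquality using (_≡_)

open import Data.Bool using (true; false; if_then_else_)
open import Data.Empty using (⊥; ⊥-elim)
open import Data.Fin as Fin using (Fin; toℕ; cast; combine; remQuot)
open import Data.Fin.Patterns using (0F; 1F)
open import Data.Fin.Properties
  using (toℕ-injective; toℕ-cast; toℕ-combine; toℕ<n; cast-involutive; remQuot-combine; combine-remQuot)
open import Data.List using ([]; _∷_; _++_; map; concatMap; filter; allFin)
open import Data.List.Membership.Propositional using (_∈_; _∉_)
open import Data.List.Membership.Propositional.Properties
  using (∈-filter⁺; ∈-filter⁻; ∈-map⁺; ∈-map⁻; ∈-concat⁺′; ∈-concat⁻′; ∈-allFin)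
open import Data.List.Membership.Propositional.Properties.WithK using (unique∧set⇒bag)
import Data.List.Membership.DecPropositional as DecMembership
open import Data.List.Properties using (filter-++; length-++; length-tabulate)
open import Data.List.Relation.Binary.BagAndSetEquality using (∼bag⇒↭)
open import Data.List.Relation.Binary.Permutation.Propositional.Properties using (↭-length)
open import Data.List.Relation.Unary.All as All using ([]; _∷_)
open import Data.List.Relation.Unary.AllPairs using ([]; _∷_)
open import Data.List.Relation.Unary.Any using (here; there)
open import Data.List.Relation.Unary.Unique.Propositional using (Unique)
import Data.List.Relation.Unary.Unique.Propositional.Properties as Unique
open import Data.Nat using (suc; _+_; _*_; _∸_; _<_; _%_; z≤n; s≤s; _<?_)
open import Data.Nat.DivMod using ([m+kn]%n≡m%n; m<n⇒m%n≡m; m%n<n)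
open import Data.Nat.Properties
open import Data.Product using (_×_; _,_; proj₁; proj₂; ∃; uncurry)
open import Data.Sum using (_⊎_; inj₁; inj₂; [_,_])
open import Function using (id; _∘_; _⇔_; mk⇔)
open import Relation.Binary.Definitions using (DecidableEquality)
open import Relation.Binary.PropositionalEquality using (_≢_; refl; sym; trans; cong; cong₂; subst; subst₂; module ≡-Reasoning)
open import Relation.Nullary using (¬_; yes; no; does)
open import Relation.Nullary.Decidable using (map′)
open import Relation.Unary using (Decidable)

module _ {A : Set} {P : A → Set} (P? : Decidable P) where

  length-filter≡sum-indicator : ∀ vs → length (filter P? vs) ≡ sum (map (λ v → if does (P? v) then 1 else 0) vs)
  length-filter≡sum-indicator [] = refl
  length-filter≡sum-indicator (v ∷ vs) with does (P? v)
  ... | true  = cong suc (length-filter≡sum-indicator vs)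
  ... | false = length-filter≡sum-indicator vs

  length-filter-concatMap : ∀ {I : Set} {c} (f : I → List A) → (∀ i → length (filter P? (f i)) ≡ c) →
                            ∀ is → length (filter P? (concatMap f is)) ≡ length is * c
  length-filter-concatMap f count [] = refl
  length-filter-concatMap {c = c} f count (i ∷ is) = begin
    length (filter P? (f i ++ concatMap f is))                     ≡⟨ cong length (filter-++ P? (f i) (concatMap f is)) ⟩
    length (filter P? (f i) ++ filter P? (concatMap f is))         ≡⟨ length-++ (filter P? (f i)) ⟩
    length (filter P? (f i)) + length (filter P? (concatMap f is)) ≡⟨ cong₂ _+_ (count i) (length-filter-concatMap f count is) ⟩
    c + length is * c                                              ∎
    where open ≡-Reasoning

  length-filter-5-cycle :
    (E : A → A → Set) → (∀ {u v} → P u → P v → ¬ E u v) →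
    ∀ {c₀ c₁ c₂ c₃ c₄} → E c₀ c₁ → E c₁ c₂ → E c₂ c₃ → E c₃ c₄ → E c₄ c₀ →
    (¬ P c₂ → P c₁ ⊎ P c₃) → (¬ P c₄ → P c₀ ⊎ P c₃) → (P c₃ → ¬ P c₀ → ¬ P c₁ → ⊥) →
    length (filter P? (c₀ ∷ c₁ ∷ c₂ ∷ c₃ ∷ c₄ ∷ [])) ≡ 2
  length-filter-5-cycle E indep {c₀} {c₁} {c₂} {c₃} {c₄} e₀₁ e₁₂ e₂₃ e₃₄ e₄₀ cover₂ cover₄ cover₃
    rewrite length-filter≡sum-indicator (c₀ ∷ c₁ ∷ c₂ ∷ c₃ ∷ c₄ ∷ [])
    with P? c₀ | P? c₁ | P? c₂ | P? c₃ | P? c₄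
  ... | yes p₀ | yes p₁ | _      | _      | _      = ⊥-elim (indep p₀ p₁ e₀₁)
  ... | _      | yes p₁ | yes p₂ | _      | _      = ⊥-elim (indep p₁ p₂ e₁₂)
  ... | _      | _      | yes p₂ | yes p₃ | _      = ⊥-elim (indep p₂ p₃ e₂₃)
  ... | _      | _      | _      | yes p₃ | yes p₄ = ⊥-elim (indep p₃ p₄ e₃₄)
  ... | yes p₀ | _      | _      | _      | yes p₄ = ⊥-elim (indep p₄ p₀ e₄₀)
  ... | no ¬p₀ | no ¬p₁ | _      | yes p₃ | _      = ⊥-elim (cover₃ p₃ ¬p₀ ¬p₁)
  ... | _      | no ¬p₁ | no ¬p₂ | no ¬p₃ | _      = ⊥-elim ([ ¬p₁ , ¬p₃ ] (cover₂ ¬p₂))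
  ... | no ¬p₀ | _      | _      | no ¬p₃ | no ¬p₄ = ⊥-elim ([ ¬p₀ , ¬p₃ ] (cover₄ ¬p₄))
  ... | yes _  | no _   | yes _  | no _   | no _   = refl
  ... | yes _  | no _   | no _   | yes _  | no _   = refl
  ... | no _   | yes _  | no _   | yes _  | no _   = refl
  ... | no _   | yes _  | no _   | no _   | yes _  = refl
  ... | no _   | no _   | yes _  | no _   | yes _  = refl

module _ {A : Set} (_≟_ : DecidableEquality A) where
  open DecMembership _≟_ using (_∈?_)

  length≡length-filter-∈ : ∀ {S P : List A} → Unique S → Unique P → (∀ {v} → v ∈ S → v ∈ P) →
                           length S ≡ length (filter (_∈? S) P)
  length≡length-filter-∈ {S} {P} uniqueS uniqueP S⊆P =
    ↭-length (∼bag⇒↭ (unique∧set⇒bag uniqueS (Unique.filter⁺ (_∈? S) uniqueP) same-elements))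
    where
    same-elements : ∀ {v} → v ∈ S ⇔ v ∈ filter (_∈? S) P
    same-elements = mk⇔ (λ v∈S → ∈-filter⁺ (_∈? S) (S⊆P v∈S) v∈S) (proj₂ ∘ ∈-filter⁻ (_∈? S) {xs = P})

module _ {I A : Set} {f : I → List A} (owner : A → I) (owner-∈ : ∀ {i v} → v ∈ f i → owner v ≡ i) where

  Unique-concatMap : (∀ i → Unique (f i)) → ∀ {is} → Unique is → Unique (concatMap f is)
  Unique-concatMap unique-f []             = []
  Unique-concatMap unique-f {i ∷ is} (i∉is ∷ uniqueIs) =
    Unique.++⁺ (unique-f i) (Unique-concatMap unique-f uniqueIs) disjoint
    where
    disjoint : ∀ {v} → ¬ (v ∈ f i × v ∈ concatMap f is)
    disjoint (v∈fi , v∈rest) with ∈-concat⁻′ (map f is) v∈rest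
    ... | vs , v∈vs , vs∈map with ∈-map⁻ f vs∈map
    ...   | j , j∈is , refl = All.lookup i∉is j∈is (trans (sym (owner-∈ v∈fi)) (owner-∈ v∈vs))


≢-≢⇒≡-below-2 : ∀ {a b c} → a < 2 → b < 2 → c < 2 → a ≢ b → b ≢ c → a ≡ c
≢-≢⇒≡-below-2 {0} {b}     {0}     _ _ _ _ _ = refl
≢-≢⇒≡-below-2 {1} {b}     {1}     _ _ _ _ _ = refl
≢-≢⇒≡-below-2 {0} {0}     {1}     _ _ _ a≢b _ = ⊥-elim (a≢b refl)
≢-≢⇒≡-below-2 {0} {1}     {1}     _ _ _ _ b≢c = ⊥-elim (b≢c refl)
≢-≢⇒≡-below-2 {1} {0}     {0}     _ _ _ _ b≢c = ⊥-elim (b≢c refl)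
≢-≢⇒≡-below-2 {1} {1}     {0}     _ _ _ a≢b _ = ⊥-elim (a≢b refl)
≢-≢⇒≡-below-2 {suc (suc _)} (s≤s (s≤s ())) _ _ _ _
≢-≢⇒≡-below-2 {_} {suc (suc _)} _ (s≤s (s≤s ())) _ _ _
≢-≢⇒≡-below-2 {_} {_} {suc (suc _)} _ _ (s≤s (s≤s ())) _ _

SameBlock-sym : ∀ ks {a b} → SameBlock ks a b → SameBlock ks b a
SameBlock-sym (k ∷ ks) (inj₁ (a< , b<))          = inj₁ (b< , a<)
SameBlock-sym (k ∷ ks) (inj₂ (a≥ , b≥ , same)) = inj₂ (b≥ , a≥ , SameBlock-sym ks same)

SameBlock-trans : ∀ ks {a b c} → SameBlock ks a b → SameBlock ks b c → SameBlock ks a c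
SameBlock-trans (k ∷ ks) (inj₁ (a< , _))      (inj₁ (_ , c<))      = inj₁ (a< , c<)
SameBlock-trans (k ∷ ks) (inj₁ (_ , b<))      (inj₂ (b≥ , _ , _))  = ⊥-elim (<⇒≱ b< b≥)
SameBlock-trans (k ∷ ks) (inj₂ (_ , b≥ , _))  (inj₁ (b< , _))      = ⊥-elim (<⇒≱ b< b≥)
SameBlock-trans (k ∷ ks) (inj₂ (a≥ , _ , ab)) (inj₂ (_ , c≥ , bc)) = inj₂ (a≥ , c≥ , SameBlock-trans ks ab bc)

2*m+r<2*k : ∀ {m k r} → m < k → r < 2 → 2 * m + r < 2 * k
2*m+r<2*k {m} {k} {r} m<k r<2 = begin-strict
  2 * m + r     <⟨ +-monoʳ-< (2 * m) r<2 ⟩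
  2 * m + 2     ≡⟨ +-comm (2 * m) 2 ⟩
  2 + 2 * m     ≡⟨ *-suc 2 m ⟨
  2 * suc m     ≤⟨ *-monoʳ-≤ 2 m<k ⟩
  2 * k         ∎
  where open ≤-Reasoning

SameBlock-pair : ∀ ks {m r s} → m < sum ks → r < 2 → s < 2 → SameBlock ks (2 * m + r) (2 * m + s)
SameBlock-pair (k ∷ ks) {m} {r} {s} m<sum r<2 s<2 with m <? k
... | yes m<k = inj₁ (2*m+r<2*k m<k r<2 , 2*m+r<2*k m<k s<2)
... | no m≮k  = inj₂ (2k≤ r , 2k≤ s , subst₂ (SameBlock ks) (shift r) (shift s) (SameBlock-pair ks m∸k<sum r<2 s<2))
  where
  k≤m = ≮⇒≥ m≮k
  2k≤2m = *-monoʳ-≤ 2 k≤m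
  2k≤ : ∀ t → 2 * k ≤ 2 * m + t
  2k≤ t = ≤-trans 2k≤2m (m≤m+n (2 * m) t)
  shift : ∀ t → 2 * (m ∸ k) + t ≡ (2 * m + t) ∸ 2 * k
  shift t = trans (cong (_+ t) (*-distribˡ-∸ 2 m k)) (sym (+-∸-comm t 2k≤2m))
  m∸k<sum : m ∸ k < sum ks
  m∸k<sum = subst (m ∸ k <_) (m+n∸m≡n k (sum ks)) (∸-monoˡ-< m<sum k≤m)

module _ {n : ℕ} where

  pair : Fin n → Fin 2 → Fin (2 * n)
  pair j r = cast (*-comm n 2) (combine j r)

  unpair : Fin (2 * n) → Fin n × Fin 2
  unpair t = remQuot 2 (cast (*-comm 2 n) t)

  half : Fin (2 * n) → Fin n
  half = proj₁ ∘ unpair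

  unpair-pair : ∀ j r → unpair (pair j r) ≡ (j , r)
  unpair-pair j r = trans (cong (remQuot 2) (cast-involutive (*-comm 2 n) (*-comm n 2) (combine j r))) (remQuot-combine j r)

  pair-unpair : ∀ t → uncurry pair (unpair t) ≡ t
  pair-unpair t = trans (cong (cast (*-comm n 2)) (combine-remQuot {n} 2 (cast (*-comm 2 n) t)))
                        (cast-involutive (*-comm n 2) (*-comm 2 n) t)

  toℕ-pair : ∀ j r → toℕ (pair j r) ≡ 2 * toℕ j + toℕ r
  toℕ-pair j r = trans (toℕ-cast (*-comm n 2) (combine j r)) (toℕ-combine j r)

  toℕ-pair%2 : ∀ j r → toℕ (pair j r) % 2 ≡ toℕ r
  toℕ-pair%2 j r = begin
    toℕ (pair j r) % 2      ≡⟨ cong (_% 2) (trans (toℕ-pair j r) (+-comm (2 * toℕ j) (toℕ r))) ⟩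
    (toℕ r + 2 * toℕ j) % 2 ≡⟨ cong (λ m → (toℕ r + m) % 2) (*-comm 2 (toℕ j)) ⟩
    (toℕ r + toℕ j * 2) % 2 ≡⟨ [m+kn]%n≡m%n (toℕ r) (toℕ j) 2 ⟩
    toℕ r % 2               ≡⟨ m<n⇒m%n≡m (toℕ<n r) ⟩
    toℕ r                   ∎
    where open ≡-Reasoning

  half-pair : ∀ j r → half (pair j r) ≡ j
  half-pair j r = cong proj₁ (unpair-pair j r)

  half-toℕ≡ : ∀ {j t} r → toℕ t ≡ 2 * toℕ j + toℕ r → half t ≡ j
  half-toℕ≡ {j} r eq = trans (cong half (toℕ-injective (trans eq (sym (toℕ-pair j r))))) (half-pair j r)

  pair-injective : ∀ {i j r s} → pair i r ≡ pair j s → (i , r) ≡ (j , s)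
  pair-injective {i} {j} {r} {s} eq = trans (sym (unpair-pair i r)) (trans (cong unpair eq) (unpair-pair j s))

  pair-0≢1 : ∀ {j} → pair j 0F ≢ pair j 1F
  pair-0≢1 eq with pair-injective eq
  ... | ()

  pair-parity-≢ : ∀ j → toℕ (pair j 0F) % 2 ≢ toℕ (pair j 1F) % 2
  pair-parity-≢ j eq = 0≢1+n (trans (sym (toℕ-pair%2 j 0F)) (trans eq (toℕ-pair%2 j 1F)))

  _≟V_ : DecidableEquality (DV n)
  x a ≟V x b = map′ (cong x) (λ { refl → refl }) (a Fin.≟ b)
  y a ≟V y b = map′ (cong y) (λ { refl → refl }) (a Fin.≟ b)
  z a ≟V z b = map′ (cong z) (λ { refl → refl }) (a Fin.≟ b)
  x _ ≟V y _ = no λ ()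
  x _ ≟V z _ = no λ ()
  y _ ≟V x _ = no λ ()
  y _ ≟V z _ = no λ ()
  z _ ≟V x _ = no λ ()
  z _ ≟V y _ = no λ ()

  -- listed in the order of the 5-cycle it induces
  chunk : Fin n → List (DV n)
  chunk j = x (pair j 0F) ∷ x (pair j 1F) ∷ y (pair j 1F) ∷ z j ∷ y (pair j 0F) ∷ []

  owner : DV n → Fin n
  owner (x t) = half t
  owner (y t) = half t
  owner (z j) = j

  owner-∈-chunk : ∀ {j v} → v ∈ chunk j → owner v ≡ j
  owner-∈-chunk {j} (here refl)                                 = half-pair j 0F
  owner-∈-chunk {j} (there (here refl))                         = half-pair j 1F
  owner-∈-chunk {j} (there (there (here refl)))                 = half-pair j 1F
  owner-∈-chunk     (there (there (there (here refl))))         = refl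
  owner-∈-chunk {j} (there (there (there (there (here refl))))) = half-pair j 0F

  ∈-chunk-owner : ∀ v → v ∈ chunk (owner v)
  ∈-chunk-owner (x t) = subst (λ u → x u ∈ chunk (half t)) (pair-unpair t) (x∈chunk (proj₂ (unpair t)))
    where
    x∈chunk : ∀ r → x (pair (half t) r) ∈ chunk (half t)
    x∈chunk 0F = here refl
    x∈chunk 1F = there (here refl)
  ∈-chunk-owner (y t) = subst (λ u → y u ∈ chunk (half t)) (pair-unpair t) (y∈chunk (proj₂ (unpair t)))
    where
    y∈chunk : ∀ r → y (pair (half t) r) ∈ chunk (half t)
    y∈chunk 0F = there (there (there (there (here refl))))
    y∈chunk 1F = there (there (here refl))
  ∈-chunk-owner (z j) = there (there (there (here refl)))

  Unique-chunk : ∀ j → Unique (chunk j)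
  Unique-chunk j = (pair-0≢1 ∘ x-injective ∷ (λ ()) ∷ (λ ()) ∷ (λ ()) ∷ [])
                 ∷ ((λ ()) ∷ (λ ()) ∷ (λ ()) ∷ [])
                 ∷ ((λ ()) ∷ pair-0≢1 ∘ sym ∘ y-injective ∷ [])
                 ∷ ((λ ()) ∷ [])
                 ∷ [] ∷ []
    where
    x-injective : ∀ {a b} → x {n} a ≡ x b → a ≡ b
    x-injective refl = refl
    y-injective : ∀ {a b} → y {n} a ≡ y b → a ≡ b
    y-injective refl = refl

  vertices : List (DV n)
  vertices = concatMap chunk (allFin n)

  Unique-vertices : Unique vertices
  Unique-vertices = Unique-concatMap owner owner-∈-chunk Unique-chunk (Unique.allFin⁺ n)

  ∈-vertices : ∀ v → v ∈ vertices
  ∈-vertices v = ∈-concat⁺′ (∈-chunk-owner v) (∈-map⁺ chunk (∈-allFin (owner v)))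

module _ (n : ℕ) (ks : List ℕ) (sum≡n : sum ks ≡ n) where

  pair-SameBlock : ∀ j → SameBlock ks (toℕ (pair {n} j 0F)) (toℕ (pair j 1F))
  pair-SameBlock j = subst₂ (SameBlock ks) (sym (toℕ-pair j 0F)) (sym (toℕ-pair j 1F))
    (SameBlock-pair ks (subst (toℕ j <_) (sym sum≡n) (toℕ<n j)) (s≤s z≤n) (s≤s (s≤s z≤n)))

  x-pair-adj : ∀ j → DEdge n ks (x (pair j 0F)) (x (pair j 1F))
  x-pair-adj j = xx (pair-SameBlock j) (pair-parity-≢ j)

  z-adj-y : ∀ j r → DEdge n ks (z j) (y (pair j r))
  z-adj-y j 0F = zy j _ (inj₁ (trans (toℕ-pair j 0F) (+-identityʳ _)))
  z-adj-y j 1F = zy j _ (inj₂ (toℕ-pair j 1F))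

  z-adj-y⇒half : ∀ {j t} → DEdge n ks (z j) (y t) → half t ≡ j
  z-adj-y⇒half (zy j t (inj₁ eq)) = half-toℕ≡ 0F (trans eq (sym (+-identityʳ _)))
  z-adj-y⇒half (zy j t (inj₂ eq)) = half-toℕ≡ 1F eq

  module _ {S : List (DV n)} (maximal : MaximalIndependent (D n ks) S) where
    open DecMembership (_≟V_ {n}) using (_∈?_)

    private
      independent = proj₁ (proj₂ maximal)
      dominating  = proj₂ (proj₂ maximal)

    y-covered : ∀ j r → y (pair j r) ∉ S → x (pair j r) ∈ S ⊎ z j ∈ S
    y-covered j r y∉S with dominating (y (pair j r)) y∉S
    ... | _ , x∈S , inj₁ (xy _) = inj₁ x∈S
    ... | _ , z∈S , inj₁ z~y@(zy _ _ _) =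
      inj₂ (subst (λ i → z i ∈ S) (trans (sym (z-adj-y⇒half z~y)) (half-pair j r)) z∈S)

    x-covered : ∀ {t} → x t ∉ S → y t ∉ S →
                ∃ λ c → x c ∈ S × SameBlock ks (toℕ c) (toℕ t) × toℕ c % 2 ≢ toℕ t % 2
    x-covered {t} x∉S y∉S with dominating (x t) x∉S
    ... | _ , c∈S , inj₁ (xx same parity) = _ , c∈S , same , parity
    ... | _ , c∈S , inj₂ (xx same parity) = _ , c∈S , SameBlock-sym ks same , parity ∘ sym
    ... | _ , y∈S , inj₂ (xy _)           = ⊥-elim (y∉S y∈S)

    z-covered : ∀ j → z j ∈ S → x (pair j 0F) ∉ S → x (pair j 1F) ∉ S → ⊥
    z-covered j z∈S x₀∉S x₁∉S
      with x-covered x₀∉S (λ y₀∈S → independent z∈S y₀∈S (inj₁ (z-adj-y j 0F)))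
         | x-covered x₁∉S (λ y₁∈S → independent z∈S y₁∈S (inj₁ (z-adj-y j 1F)))
    ... | c , c∈S , c~x₀ , c≢x₀ | d , d∈S , d~x₁ , d≢x₁ =
      independent c∈S d∈S (inj₁ (xx c~d (λ c≡d → d≢x₁ (trans (sym c≡d) c≡x₁))))
      where
      c~d : SameBlock ks (toℕ c) (toℕ d)
      c~d = SameBlock-trans ks c~x₀ (SameBlock-trans ks (pair-SameBlock j) (SameBlock-sym ks d~x₁))
      c≡x₁ : toℕ c % 2 ≡ toℕ (pair j 1F) % 2
      c≡x₁ = ≢-≢⇒≡-below-2 (m%n<n (toℕ c) 2) (m%n<n (toℕ (pair j 0F)) 2) (m%n<n (toℕ (pair j 1F)) 2)
                           c≢x₀ (pair-parity-≢ j)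

    length-filter-chunk : ∀ j → length (filter (_∈? S) (chunk j)) ≡ 2
    length-filter-chunk j = length-filter-5-cycle (_∈? S) (Adj (D n ks)) independent
      (inj₁ (x-pair-adj j)) (inj₁ (xy _)) (inj₂ (z-adj-y j 1F)) (inj₁ (z-adj-y j 0F)) (inj₂ (xy _))
      (y-covered j 1F) (y-covered j 0F) (z-covered j)

    length-maximalIndependent : length S ≡ 2 * n
    length-maximalIndependent = begin
      length S                         ≡⟨ length≡length-filter-∈ _≟V_ (proj₁ maximal) Unique-vertices (λ {v} _ → ∈-vertices v) ⟩
      length (filter (_∈? S) vertices) ≡⟨ length-filter-concatMap (_∈? S) chunk length-filter-chunk (allFin n) ⟩
      length (allFin n) * 2            ≡⟨ cong (_* 2) (length-tabulate {n = n} id) ⟩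
      n * 2                            ≡⟨ *-comm n 2 ⟩
      2 * n                            ∎
      where open ≡-Reasoning

lemma6p2 : (n : ℕ) (ks : List ℕ) → 1 ≤ length ks → All (2 ≤_) ks →
    sum ks ≡ n → WellCovered (D n ks)
lemma6p2 n ks _ _ sum≡n S T maximalS maximalT =
  trans (length-maximalIndependent n ks sum≡n maximalS) (sym (length-maximalIndependent n ks sum≡n maximalT))
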